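{- Let $G$ be a finite simple graph that has a perfect matching and let $M$ be any perfect matching of $G$. Then every vertex $v \in V_{SD}(G)$ is a vertex of some $M$-Jposy.
   Context: A walk is $M$-alternating if, for each pair of consecutive edges, exactly one belongs to $M$. An $M$-blossom is an odd cycle of length $2k+1$ containing exactly $k$ edges of $M$; its base is the unique vertex of the cycle not matched by $M$ to another vertex of the cycle. An $M$-Jposy is a configuration consisting of two, not necessarily distinct, $M$-blossoms joined by an odd-length $M$-alternating walk (starting and ending with edges of $M$) whose endpoints are the bases of the two blossoms. For a graph with a perfect matching, $V_{SD}(G)$ is the set of vertices of $G$ that lie on an $M'$-Jposy for some perfect matching $M'$ of $G$. -}

module Defs where

open import Data.Nat using (ℕ; zero; suc; _+_; _*_; _≤_)
open import Data.Fin using (Fin)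
open import Data.Bool using (Bool; true; false; _xor_)
open import Data.List using (List; []; _∷_; _++_; [_]; length)
open import Data.List.Membership.Propositional using (_∈_)
open import Data.List.Relation.Unary.All using (All)
open import Data.List.Relation.Unary.AllPairs using (AllPairs)
open import Data.Product using (_×_; _,_; Σ; ∃; ∃-syntax)
open import Data.Sum using (_⊎_)
open import Relation.Binary.PropositionalEquality using (_≡_; _≢_)

record SimpleGraph (n : ℕ) : Set where
  field
    Adj    : Fin n → Fin n → Bool
    sym    : ∀ u v → Adj u v ≡ Adj v u
    irrefl : ∀ v → Adj v v ≡ false
open SimpleGraph public

record IsPerfectMatching {n : ℕ} (G : SimpleGraph n) (M : Fin n → Fin n → Bool) : Set where
  field
    sub    : ∀ u v → M u v ≡ true → Adj G u v ≡ true
    msym   : ∀ u v → M u v ≡ M v u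
    unique : ∀ v → ∃[ u ] (M v u ≡ true × (∀ w → M v w ≡ true → w ≡ u))

pairs : {A : Set} → List A → List (A × A)
pairs []            = []
pairs (x ∷ [])      = []
pairs (x ∷ y ∷ r)   = (x , y) ∷ pairs (y ∷ r)

Edge : ℕ → Set
Edge n = Fin n × Fin n

inM : {n : ℕ} → (Fin n → Fin n → Bool) → Edge n → Bool
inM M (a , b) = M a b

countM : {n : ℕ} → (Fin n → Fin n → Bool) → List (Edge n) → ℕ
countM M []       = 0
countM M (e ∷ es) with inM M e
... | true  = suc (countM M es)
... | false = countM M es

AllAdjacent : {n : ℕ} → SimpleGraph n → List (Edge n) → Set
AllAdjacent G es = All (λ e → inM (Adj G) e ≡ true) es

Alternating : {n : ℕ} → (Fin n → Fin n → Bool) → List (Edge n) → Set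
Alternating M es = All (λ p → (inM M (Data.Product.proj₁ p) xor inM M (Data.Product.proj₂ p)) ≡ true) (pairs es)

-- An M-blossom: a cycle v0 v1 ... v(2k) v0 (distinct vertices, k ≥ 1, since a
-- simple graph has no cycles of length 1) containing exactly k edges of M,
-- together with its base: the vertex of the cycle not matched by M to
-- another vertex of the cycle.
record Blossom {n : ℕ} (G : SimpleGraph n) (M : Fin n → Fin n → Bool) : Set where
  field
    k         : ℕ
    k≥1       : 1 ≤ k
    v₀        : Fin n
    rest      : List (Fin n)
    len       : length (v₀ ∷ rest) ≡ suc (2 * k)
    distinct  : AllPairs _≢_ (v₀ ∷ rest)
    adjacent  : AllAdjacent G (pairs ((v₀ ∷ rest) ++ [ v₀ ]))
    kMedges   : countM M (pairs ((v₀ ∷ rest) ++ [ v₀ ])) ≡ k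
    base      : Fin n
    base∈     : base ∈ (v₀ ∷ rest)
    baseUnmatched : ∀ w → w ∈ (v₀ ∷ rest) → M base w ≡ false

  vertices : List (Fin n)
  vertices = v₀ ∷ rest
open Blossom public

-- An M-Jposy: two (not necessarily distinct) M-blossoms joined by an
-- odd-length M-alternating walk, starting and ending with edges of M, whose
-- endpoints are the bases of the two blossoms.
record Jposy {n : ℕ} (G : SimpleGraph n) (M : Fin n → Fin n → Bool) : Set where
  field
    B₁ B₂     : Blossom G M
    walk      : List (Fin n)
    walkAdj   : AllAdjacent G (pairs walk)
    oddLength : ∃[ m ] length (pairs walk) ≡ suc (2 * m)
    alternating : Alternating M (pairs walk)
    firstEdge : ∃[ e ] ∃[ es ] (pairs walk ≡ e ∷ es × inM M e ≡ true)
    lastEdge  : ∃[ e ] ∃[ es ] (pairs walk ≡ es ++ [ e ] × inM M e ≡ true)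
    startBase : ∃[ ws ] walk ≡ base B₁ ∷ ws
    endBase   : ∃[ ws ] walk ≡ ws ++ [ base B₂ ]
open Jposy public

OnJposy : {n : ℕ} {G : SimpleGraph n} {M : Fin n → Fin n → Bool} → Fin n → Jposy G M → Set
OnJposy v J = v ∈ vertices (B₁ J) ⊎ v ∈ vertices (B₂ J) ⊎ v ∈ walk J

InVSD : {n : ℕ} → SimpleGraph n → Fin n → Set
InVSD G v = ∃[ M' ] (IsPerfectMatching G M' × Σ (Jposy G M') (λ J → OnJposy v J))

-- Let μ be the partner map of a perfect matching M and D(G, M) the digraph with an arc a ⟶ b
-- for every unmatched edge μ a — b. A vertex v lies on an M-Jposy exactly when v and μ v lie in
-- the same strong component of D(G, M), and this condition does not depend on M.
--
-- Jposy ⇒ component: the walk of a Jposy, a round of the far blossom, the walk backwards and a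
-- round of the near blossom (each round in either direction) form closed alternating walks at
-- the near base that visit every vertex of the Jposy with both parities; a closed alternating
-- walk visiting y with parity u puts y or μ y into the strong component of its base.
--
-- Component ⇒ Jposy: follow the alternating walk v, μ v, …, μ v described by a D-path from v
-- to μ v, keeping a simple alternating path from v and cutting it back whenever a vertex recurs
-- with the same parity. A vertex recurring with the other parity closes an odd cycle, which is
-- a blossom with an alternating stem from v; this must happen, since otherwise the path would
-- end at μ v with an unmatched edge. Blossoms found from v and from μ v, joined through v, form
-- a Jposy.
--
-- Independence of M: for a second perfect matching M′ the permutation μ′ ∘ μ moves every vertex
-- along a path of D(G, M); having finite order it also moves every vertex back, and this turns
-- each arc of D(G, M′) into a path of D(G, M).

module Submission where

open import Defs renaming (sym to Adj-symmetric; irrefl to Adj-irreflexive)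
open import Data.Bool using (Bool; true; false; not; _xor_)
open import Data.Bool.Properties using (not-involutive; ¬-not) renaming (_≟_ to _≟ᵇ_)
open import Data.Empty using (⊥-elim)
open import Data.Fin using (Fin; toℕ)
open import Data.Fin.Properties using (pigeonhole) renaming (_≟_ to _≟ᶠ_)
open import Data.List using (List; []; _∷_; _++_; [_]; length; map; reverse)
open import Data.List.Properties using (++-assoc; ++-identityʳ; ∷ʳ-injective; unfold-reverse)
open import Data.List.Membership.Propositional using (_∈_; _∉_)
open import Data.List.Membership.Propositional.Properties using (∈-∃++; ∈-++⁺ˡ)
open import Data.List.Relation.Unary.All using (All; []; _∷_)
import Data.List.Relation.Unary.All as All
open import Data.List.Relation.Unary.All.Properties using (¬Any⇒All¬; ++⁻ˡ)
open import Data.List.Relation.Unary.AllPairs using (AllPairs; []; _∷_)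
import Data.List.Relation.Unary.AllPairs as AllPairs
open import Data.List.Relation.Unary.Any using (here; there)
open import Data.List.Relation.Binary.Permutation.Propositional
  using (_↭_; ↭-reflexive; ↭-prep; ↭-swap; ↭-trans; ↭-sym; ↭⇒↭ₛ)
open import Data.List.Relation.Binary.Permutation.Propositional.Properties
  using (++-comm; shift; ∈-resp-↭; All-resp-↭; ↭-length; ↭-reverse) renaming (map⁺ to ↭-map⁺)
open import Data.List.Relation.Binary.Permutation.Setoid.Properties using (Unique-resp-↭)
open import Data.Nat using (ℕ; zero; suc; _+_; _*_; _≤_; z≤n; s≤s)
open import Data.Nat.GeneralisedArithmetic using (fold; iterate; iterate-is-fold)
open import Data.Nat.ListAction using (sum)
open import Data.Nat.ListAction.Properties using (sum-↭)
open import Data.Nat.Properties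
  using (module ≤-Reasoning; +-suc; *-suc; suc-injective; n<1+n; m≤n⇒m≤1+n; 1+n≰n; m≤n⇒∃[o]m+o≡n)
open import Data.Product using (Σ; ∃-syntax; _×_; _,_; proj₁; proj₂; map₁; map₂)
open import Data.Sum using (_⊎_; inj₁; inj₂)
open import Function using (_∘′_)
open import Function.Definitions using (Injective)
open import Relation.Binary.Construct.Closure.ReflexiveTransitive using (Star; ε; _◅_; _◅◅_; _⋆)
open import Relation.Binary.PropositionalEquality
  using (_≡_; _≢_; refl; sym; trans; cong; cong₂; subst; setoid; module ≡-Reasoning)
open import Relation.Nullary using (yes; no)

bit : Bool → ℕ
bit true  = 1
bit false = 0

xor-not : ∀ x → x xor not x ≡ true
xor-not true  = refl
xor-not false = refl

xor≡true⇒≡not : ∀ {x y} → x xor y ≡ true → y ≡ not x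
xor≡true⇒≡not {true}  {false} _ = refl
xor≡true⇒≡not {false} {true}  _ = refl

module _ {A : Set} where

  AllPairs-++⁻ˡ : {R : A → A → Set} (xs : List A) {ys : List A} → AllPairs R (xs ++ ys) → AllPairs R xs
  AllPairs-++⁻ˡ []       _           = []
  AllPairs-++⁻ˡ (x ∷ xs) (x∼ ∷ xs∼) = ++⁻ˡ xs x∼ ∷ AllPairs-++⁻ˡ xs xs∼

  distinct-↭ : {xs ys : List A} → xs ↭ ys → AllPairs _≢_ xs → AllPairs _≢_ ys
  distinct-↭ p = Unique-resp-↭ (setoid A) (↭⇒↭ₛ p)

  close : List A → List A
  close []       = []
  close (x ∷ xs) = x ∷ xs ++ [ x ]

  pairs-++-∷ : (xs : List A) (y : A) (ys : List A) →
    pairs (xs ++ y ∷ ys) ≡ pairs (xs ++ [ y ]) ++ pairs (y ∷ ys)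
  pairs-++-∷ []            y ys = refl
  pairs-++-∷ (x ∷ [])      y ys = refl
  pairs-++-∷ (x ∷ x′ ∷ xs) y ys = cong ((x , x′) ∷_) (pairs-++-∷ (x′ ∷ xs) y ys)

  pairs-∷ʳ : (x : A) (xs : List A) (z : A) →
    ∃[ y ] y ∈ x ∷ xs × pairs (x ∷ xs ++ [ z ]) ≡ pairs (x ∷ xs) ++ [ (y , z) ]
  pairs-∷ʳ x []       z = x , here refl , refl
  pairs-∷ʳ x (y ∷ xs) z with pairs-∷ʳ y xs z
  ... | w , w∈ , eq = w , there w∈ , cong ((x , y) ∷_) eq

  length-pairs-∷ʳ : (x : A) (xs : List A) (z : A) → length (pairs (x ∷ xs ++ [ z ])) ≡ suc (length xs)
  length-pairs-∷ʳ x []       z = refl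
  length-pairs-∷ʳ x (y ∷ xs) z = cong suc (length-pairs-∷ʳ y xs z)

  pairs-close-++ : (x : A) (xs : List A) (y : A) (ys : List A) →
    pairs (close (x ∷ xs ++ y ∷ ys)) ≡ pairs (x ∷ xs ++ [ y ]) ++ pairs (y ∷ ys ++ [ x ])
  pairs-close-++ x xs y ys =
    trans (cong (λ zs → pairs (x ∷ zs)) (++-assoc xs (y ∷ ys) [ x ])) (pairs-++-∷ (x ∷ xs) y (ys ++ [ x ]))

  pairs-close-rotate : (xs ys : List A) → pairs (close (xs ++ ys)) ↭ pairs (close (ys ++ xs))
  pairs-close-rotate []       ys       = ↭-reflexive (cong (pairs ∘′ close) (sym (++-identityʳ ys)))
  pairs-close-rotate (x ∷ xs) []       = ↭-reflexive (cong (pairs ∘′ close) (++-identityʳ (x ∷ xs)))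
  pairs-close-rotate (x ∷ xs) (y ∷ ys) = ↭-trans (↭-reflexive (pairs-close-++ x xs y ys))
    (↭-trans (++-comm (pairs (x ∷ xs ++ [ y ])) (pairs (y ∷ ys ++ [ x ])))
      (↭-reflexive (sym (pairs-close-++ y ys x xs))))

module _ {A : Set} {f : A → A} where

  fold-cancel : Injective _≡_ _≡_ f → ∀ i d {z} → fold z f i ≡ fold z f (i + d) → z ≡ fold z f d
  fold-cancel f-injective zero    d eq = eq
  fold-cancel f-injective (suc i) d eq = fold-cancel f-injective i d (f-injective eq)

  star-iterate : {R : A → A → Set} → (∀ a → Star R a (f a)) → ∀ k z → Star R z (iterate f z k)
  star-iterate step zero    z = ε
  star-iterate step (suc k) z = step z ◅◅ star-iterate step k (f z)

module _ {n : ℕ} {f : Fin n → Fin n} (f-injective : Injective _≡_ _≡_ f) where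

  iterate-returns : ∀ z → ∃[ k ] iterate f z (suc k) ≡ z
  iterate-returns z with pigeonhole (n<1+n n) (λ i → fold z f (toℕ i))
  ... | i , j , i<j , eq with m≤n⇒∃[o]m+o≡n i<j
  ... | o , i+o≡j = o , (begin
    iterate f z (suc o) ≡⟨ sym (iterate-is-fold z f (suc o)) ⟩
    fold z f (suc o)    ≡⟨ sym (fold-cancel f-injective (toℕ i) (suc o) (trans eq (cong (fold z f) j≡))) ⟩
    z                   ∎)
    where
      open ≡-Reasoning
      j≡ : toℕ j ≡ toℕ i + suc o
      j≡ = sym (trans (+-suc (toℕ i) o) i+o≡j)

  star-back : {R : Fin n → Fin n → Set} → (∀ a → Star R a (f a)) → ∀ z → Star R (f z) z
  star-back step z with iterate-returns z
  ... | k , returns = subst (Star _ (f z)) returns (star-iterate step k (f z))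

module Counting {n : ℕ} (M : Fin n → Fin n → Bool) where

  countM-∷ : ∀ e es → countM M (e ∷ es) ≡ bit (inM M e) + countM M es
  countM-∷ e es with inM M e
  ... | true  = refl
  ... | false = refl

  countM-unmatched : ∀ {e} es → inM M e ≡ false → countM M (e ∷ es) ≡ countM M es
  countM-unmatched {e} es q = trans (countM-∷ e es) (cong (λ x → bit x + countM M es) q)

  countM-alternating : ∀ {e e′} es → inM M e ≡ true → inM M e′ ≡ false →
    countM M (e ∷ e′ ∷ es) ≡ suc (countM M es)
  countM-alternating {e} {e′} es q q′ =
    trans (countM-∷ e (e′ ∷ es)) (cong₂ (λ x y → bit x + y) q (countM-unmatched es q′))

  countM-↭ : ∀ {es es′} → es ↭ es′ → countM M es ≡ countM M es′
  countM-↭ {es} {es′} p = begin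
    countM M es                  ≡⟨ countM-sum es ⟩
    sum (map (bit ∘′ inM M) es)  ≡⟨ sum-↭ (↭-map⁺ (bit ∘′ inM M) p) ⟩
    sum (map (bit ∘′ inM M) es′) ≡⟨ sym (countM-sum es′) ⟩
    countM M es′                 ∎
    where
      open ≡-Reasoning
      countM-sum : ∀ es → countM M es ≡ sum (map (bit ∘′ inM M) es)
      countM-sum []       = refl
      countM-sum (e ∷ es) = trans (countM-∷ e es) (cong (bit (inM M e) +_) (countM-sum es))

  data Sparse : List (Edge n) → Set where
    []        : Sparse []
    unmatched : ∀ {e es} → inM M e ≡ false → Sparse es → Sparse (e ∷ es)
    matched   : ∀ {e e′ es} → inM M e ≡ true → inM M e′ ≡ false → Sparse es → Sparse (e ∷ e′ ∷ es)

  sparse-∷ : ∀ {e e′ es} → (inM M e ≡ true → inM M e′ ≡ false) → Sparse (e′ ∷ es) → Sparse es →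
    Sparse (e ∷ e′ ∷ es)
  sparse-∷ {e} next s s′ with inM M e in q
  ... | false = unmatched q s
  ... | true  = matched q (next refl) s′

  sparse-bound : ∀ {es} → Sparse es → 2 * countM M es ≤ length es
  sparse-bound []                        = z≤n
  sparse-bound (unmatched {es = es} q s) = begin
    2 * countM M (_ ∷ es) ≡⟨ cong (2 *_) (countM-unmatched es q) ⟩
    2 * countM M es       ≤⟨ m≤n⇒m≤1+n (sparse-bound s) ⟩
    suc (length es)       ∎
    where open ≤-Reasoning
  sparse-bound (matched {es = es} q q′ s) = begin
    2 * countM M (_ ∷ _ ∷ es)   ≡⟨ cong (2 *_) (countM-alternating es q q′) ⟩
    2 * suc (countM M es)       ≡⟨ *-suc 2 (countM M es) ⟩
    suc (suc (2 * countM M es)) ≤⟨ s≤s (s≤s (sparse-bound s)) ⟩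
    suc (suc (length es))       ∎
    where open ≤-Reasoning

  sparse-alternating : ∀ {e es} → inM M e ≡ false → Sparse es → length es ≡ 2 * countM M es →
    Alternating M (e ∷ es)
  sparse-alternating q [] _ = []
  sparse-alternating q (unmatched {es = es} q′ s) len = ⊥-elim (1+n≰n (begin
    suc (length es)       ≡⟨ len ⟩
    2 * countM M (_ ∷ es) ≡⟨ cong (2 *_) (countM-unmatched es q′) ⟩
    2 * countM M es       ≤⟨ sparse-bound s ⟩
    length es             ∎))
    where open ≤-Reasoning
  sparse-alternating q (matched {es = es} q₁ q₂ s) len =
    cong₂ _xor_ q q₁ ∷ cong₂ _xor_ q₁ q₂ ∷ sparse-alternating q₂ s (suc-injective (suc-injective (begin
      suc (suc (length es))       ≡⟨ len ⟩
      2 * countM M (_ ∷ _ ∷ es)   ≡⟨ cong (2 *_) (countM-alternating es q₁ q₂) ⟩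
      2 * suc (countM M es)       ≡⟨ *-suc 2 (countM M es) ⟩
      suc (suc (2 * countM M es)) ∎)))
    where open ≡-Reasoning

module AlternatingWalk {n : ℕ} (G : SimpleGraph n) (M : Fin n → Fin n → Bool) where

  open Counting M

  infixr 5 _++ᵂ_

  data AltWalk : Fin n → Fin n → Bool → Bool → Set where
    edge : ∀ {a b s} → Adj G a b ≡ true → M a b ≡ s → AltWalk a b s s
    step : ∀ {a b c s t} → Adj G a b ≡ true → M a b ≡ s → AltWalk b c (not s) t → AltWalk a c s t

  private variable
    a b c c′ y : Fin n
    s t t′ u v : Bool
    us : List (Fin n)

  mutual
    verticesᵂ : AltWalk a c s t → List (Fin n)
    verticesᵂ {a = a} w = a ∷ successors w

    successors : AltWalk a c s t → List (Fin n)
    successors (edge {b = b} _ _) = [ b ]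
    successors (step _ _ w)       = verticesᵂ w

  _++ᵂ_ : AltWalk a b s t → AltWalk b c (not t) u → AltWalk a c s u
  edge e q   ++ᵂ w′ = step e q w′
  step e q w ++ᵂ w′ = step e q (w ++ᵂ w′)

  verticesᵂ-++ᵂ : (w : AltWalk a b s t) (w′ : AltWalk b c (not t) u) →
    verticesᵂ (w ++ᵂ w′) ≡ verticesᵂ w ++ successors w′
  verticesᵂ-++ᵂ         (edge _ _)   w′ = refl
  verticesᵂ-++ᵂ {a = a} (step _ _ w) w′ = cong (a ∷_) (verticesᵂ-++ᵂ w w′)

  verticesᵂ-∷ʳ : (w : AltWalk a c s t) → ∃[ vs ] verticesᵂ w ≡ vs ++ [ c ]
  verticesᵂ-∷ʳ {a = a} (edge _ _)   = [ a ] , refl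
  verticesᵂ-∷ʳ {a = a} (step _ _ w) with verticesᵂ-∷ʳ w
  ... | vs , eq = a ∷ vs , cong (a ∷_) eq

  -- In Visits y u w, u is the status of the edge on which w leaves y; at the final vertex it is
  -- the status an alternating continuation would have.
  data Visits : Fin n → Bool → AltWalk a c s t → Set where
    start : {w : AltWalk a c s t} → Visits a s w
    end   : {e : Adj G a b ≡ true} {q : M a b ≡ s} → Visits b (not s) (edge e q)
    later : {e : Adj G a b ≡ true} {q : M a b ≡ s} {w : AltWalk b c (not s) t} →
            Visits y u w → Visits y u (step e q w)

  visits-end : (w : AltWalk a c s t) → Visits c (not t) w
  visits-end (edge _ _)   = end
  visits-end (step _ _ w) = later (visits-end w)

  visits-++ˡ : (w : AltWalk a b s t) (w′ : AltWalk b c (not t) u) → Visits y v w → Visits y v (w ++ᵂ w′)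
  visits-++ˡ (edge _ _)   w′ start     = start
  visits-++ˡ (edge _ _)   w′ end       = later start
  visits-++ˡ (step _ _ w) w′ start     = start
  visits-++ˡ (step _ _ w) w′ (later v) = later (visits-++ˡ w w′ v)

  visits-++ʳ : (w : AltWalk a b s t) (w′ : AltWalk b c (not t) u) → Visits y v w′ → Visits y v (w ++ᵂ w′)
  visits-++ʳ (edge _ _)   w′ v = later v
  visits-++ʳ (step _ _ w) w′ v = later (visits-++ʳ w w′ v)

  ∈⇒visits : (w : AltWalk a c s t) → y ∈ verticesᵂ w → ∃[ u ] Visits y u w
  ∈⇒visits (edge _ _)   (here refl)         = _ , start
  ∈⇒visits (edge _ _)   (there (here refl)) = _ , end
  ∈⇒visits (step _ _ w) (here refl)         = _ , start
  ∈⇒visits (step _ _ w) (there y∈)          = map₂ later (∈⇒visits w y∈)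

  visits⇒∈ : {w : AltWalk a c s t} → Visits y u w → y ∈ verticesᵂ w
  visits⇒∈ start     = here refl
  visits⇒∈ end       = there (here refl)
  visits⇒∈ (later v) = there (visits⇒∈ v)

  module _ (M-sym : ∀ u v → M u v ≡ M v u) where

    private
      flip-edge : Adj G a b ≡ true → M a b ≡ s → AltWalk b a s s
      flip-edge {a = a} {b = b} e q = edge (trans (Adj-symmetric G b a) e) (trans (M-sym b a) q)

    reverseᵂ : AltWalk a c s t → AltWalk c a t s
    reverseᵂ (edge e q)               = flip-edge e q
    reverseᵂ (step {s = true}  e q w) = reverseᵂ w ++ᵂ flip-edge e q
    reverseᵂ (step {s = false} e q w) = reverseᵂ w ++ᵂ flip-edge e q

    visits-reverse : (w : AltWalk a c s t) → Visits y u w → Visits y (not u) (reverseᵂ w)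
    visits-reverse (edge e q)               start     = end
    visits-reverse (edge {s = true}  e q)   end       = start
    visits-reverse (edge {s = false} e q)   end       = start
    visits-reverse (step {s = true}  e q w) start     = visits-end (reverseᵂ w ++ᵂ flip-edge e q)
    visits-reverse (step {s = false} e q w) start     = visits-end (reverseᵂ w ++ᵂ flip-edge e q)
    visits-reverse (step {s = true}  e q w) (later v) = visits-++ˡ (reverseᵂ w) _ (visits-reverse w v)
    visits-reverse (step {s = false} e q w) (later v) = visits-++ˡ (reverseᵂ w) _ (visits-reverse w v)

  EdgesStartWith : Bool → List (Edge n) → Set
  EdgesStartWith s es = ∃[ e ] ∃[ es′ ] (es ≡ e ∷ es′ × inM M e ≡ s)

  EdgesEndWith : Bool → List (Edge n) → Set
  EdgesEndWith t es = ∃[ e ] ∃[ es′ ] (es ≡ es′ ++ [ e ] × inM M e ≡ t)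

  adjacentᵂ : (w : AltWalk a c s t) → AllAdjacent G (pairs (verticesᵂ w))
  adjacentᵂ (edge e _)   = e ∷ []
  adjacentᵂ (step e _ w) = e ∷ adjacentᵂ w

  private
    alternate : M a b ≡ s → M b c ≡ not s → M a b xor M b c ≡ true
    alternate {s = s} q q′ = trans (cong₂ _xor_ q q′) (xor-not s)

  alternatingᵂ : (w : AltWalk a c s t) → Alternating M (pairs (verticesᵂ w))
  alternatingᵂ (edge _ _)                 = []
  alternatingᵂ (step _ q (edge _ q′))     = alternate q q′ ∷ []
  alternatingᵂ (step _ q w@(step _ q′ _)) = alternate q q′ ∷ alternatingᵂ w

  first-edge : (w : AltWalk a c s t) → EdgesStartWith s (pairs (verticesᵂ w))
  first-edge (edge _ q)   = _ , _ , refl , q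
  first-edge (step _ q _) = _ , _ , refl , q

  last-edge : (w : AltWalk a c s t) → EdgesEndWith t (pairs (verticesᵂ w))
  last-edge (edge _ q) = _ , [] , refl , q
  last-edge {a = a} (step {b = b} _ _ w) with last-edge w
  ... | e , es , eq , q = e , (a , b) ∷ es , cong ((a , b) ∷_) eq , q

  matched-count : (w : AltWalk a c s t) →
    bit s + bit t + length (pairs (verticesᵂ w)) ≡ suc (2 * countM M (pairs (verticesᵂ w)))
  matched-count (edge {s = true}  _ q) rewrite q = refl
  matched-count (edge {s = false} _ q) rewrite q = refl
  matched-count {t = t} (step {s = true} _ q w) rewrite q = begin
    suc (bit t + suc L)     ≡⟨ cong suc (+-suc (bit t) L) ⟩
    suc (suc (bit t + L))   ≡⟨ cong (suc ∘′ suc) (matched-count w) ⟩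
    suc (suc (suc (2 * C))) ≡⟨ cong suc (sym (*-suc 2 C)) ⟩
    suc (2 * suc C)         ∎
    where
      open ≡-Reasoning
      L = length (pairs (verticesᵂ w))
      C = countM M (pairs (verticesᵂ w))
  matched-count {t = t} (step {s = false} _ q w) rewrite q =
    trans (+-suc (bit t) (length (pairs (verticesᵂ w)))) (matched-count w)

  fromList : (a b : Fin n) (rs : List (Fin n)) → M a b ≡ s →
    AllAdjacent G (pairs (a ∷ b ∷ rs)) → Alternating M (pairs (a ∷ b ∷ rs)) →
    ∃[ c ] ∃[ t ] Σ (AltWalk a c s t) λ w → verticesᵂ w ≡ a ∷ b ∷ rs
  fromList a b []       q (e ∷ []) []       = b , _ , edge e q , refl
  fromList a b (c ∷ rs) q (e ∷ es) (x ∷ xs) with fromList b c rs (trans (xor≡true⇒≡not x) (cong not q)) es xs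
  ... | d , t , w , eq = d , t , step e q w , cong (a ∷_) eq

  last-vertex-≡ : (w : AltWalk a c s t) → verticesᵂ w ≡ us ++ [ c′ ] → c ≡ c′
  last-vertex-≡ {us = us} w eq with verticesᵂ-∷ʳ w
  ... | vs , eq′ = proj₂ (∷ʳ-injective vs us (trans (sym eq′) eq))

  last-status-≡ : (w : AltWalk a c s t) → EdgesEndWith t′ (pairs (verticesᵂ w)) → t ≡ t′
  last-status-≡ w (e , es , eq , q) with last-edge w
  ... | e′ , es′ , eq′ , q′ =
    trans (sym q′) (trans (cong (inM M) (proj₂ (∷ʳ-injective es′ es (trans (sym eq′) eq)))) q)

  fromList-between : (ws : List (Fin n)) → AllAdjacent G (pairs ws) → Alternating M (pairs ws) →
    EdgesStartWith s (pairs ws) → EdgesEndWith t (pairs ws) →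
    (∃[ us ] ws ≡ a ∷ us) → (∃[ us ] ws ≡ us ++ [ c ]) →
    Σ (AltWalk a c s t) λ w → verticesᵂ w ≡ ws
  fromList-between []           _   _   (_ , _ , () , _)   _    _          _
  fromList-between (_ ∷ [])     _   _   (_ , _ , () , _)   _    _          _
  fromList-between (a ∷ b ∷ rs) adj alt (_ , _ , refl , q) ends (_ , refl) (_ , ends-in)
    with fromList a b rs q adj alt
  ... | _ , _ , w , w≡
    with last-vertex-≡ w (trans w≡ ends-in) | last-status-≡ w (subst (EdgesEndWith _ ∘′ pairs) (sym w≡) ends)
  ... | refl | refl = w , w≡

module Matching {n : ℕ} (G : SimpleGraph n) (M : Fin n → Fin n → Bool) (pm : IsPerfectMatching G M) where

  open IsPerfectMatching pm
  open Counting M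
  open AlternatingWalk G M

  private variable
    a b c v y z : Fin n
    s t u : Bool
    us : List (Fin n)

  μ : Fin n → Fin n
  μ v = proj₁ (unique v)

  matched-μ : ∀ v → M v (μ v) ≡ true
  matched-μ v = proj₁ (proj₂ (unique v))

  μ-unique : M v a ≡ true → a ≡ μ v
  μ-unique {v} {a} = proj₂ (proj₂ (unique v)) a

  M-sym : M a b ≡ t → M b a ≡ t
  M-sym {a} {b} = trans (msym b a)

  matched-twice : M a b ≡ true → M b c ≡ true → a ≡ c
  matched-twice ab bc = trans (μ-unique (M-sym ab)) (sym (μ-unique bc))

  matched-then-unmatched : ∀ {a b c} → a ≢ c → M a b ≡ true → M b c ≡ false
  matched-then-unmatched {b = b} {c} a≢c ab with M b c in bc
  ... | false = refl
  ... | true  = ⊥-elim (a≢c (matched-twice ab bc))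

  μ-involutive : ∀ v → μ (μ v) ≡ v
  μ-involutive v = sym (μ-unique (M-sym (matched-μ v)))

  adj-μ : ∀ v → Adj G v (μ v) ≡ true
  adj-μ v = sub v (μ v) (matched-μ v)

  adj-irrefl : Adj G a b ≡ true → a ≢ b
  adj-irrefl {a} e refl with () ← trans (sym e) (Adj-irreflexive G a)

  rev : AltWalk a c s t → AltWalk c a t s
  rev = reverseᵂ msym

  rev-visits : (w : AltWalk a c s t) → Visits y u w → Visits y (not u) (rev w)
  rev-visits = visits-reverse msym

  split-first : AltWalk a c true true → M a v ≡ true → c ≡ v ⊎ AltWalk v c false true
  split-first (edge _ q)   m = inj₁ (matched-twice (M-sym q) m)
  split-first (step _ q w) m with matched-twice (M-sym q) m
  ... | refl = inj₂ w

  -- Blossoms and Jposies as alternating walks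

  cycle-sparse : ∀ us → AllPairs _≢_ us → (∀ u → u ∈ us → M u z ≡ false) → Sparse (pairs (us ++ [ z ]))
  cycle-sparse []           _ _   = []
  cycle-sparse (u ∷ [])     _ unm = unmatched (unm u (here refl)) []
  cycle-sparse (u ∷ v ∷ []) _ unm =
    sparse-∷ (λ _ → unm v (there (here refl))) (unmatched (unm v (there (here refl))) []) []
  cycle-sparse (u ∷ v ∷ w ∷ ws) ((_ ∷ u≢w ∷ _) ∷ distinct@(_ ∷ distinct′)) unm =
    sparse-∷ (matched-then-unmatched u≢w)
      (cycle-sparse (v ∷ w ∷ ws) distinct (λ x → unm x ∘′ there))
      (cycle-sparse (w ∷ ws) distinct′ (λ x → unm x ∘′ there ∘′ there))

  -- The matched edges of a cycle through distinct vertices are pairwise non-adjacent; if they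
  -- also avoid b and number k out of 2k + 1, the cycle read from b must alternate.
  closed-list⇒cycle : ∀ b us → AllPairs _≢_ (b ∷ us) → (∀ u → u ∈ b ∷ us → M u b ≡ false) →
    AllAdjacent G (pairs (close (b ∷ us))) →
    length (pairs (close (b ∷ us))) ≡ suc (2 * countM M (pairs (close (b ∷ us)))) →
    Σ (AltWalk b b false false) λ C → verticesᵂ C ≡ close (b ∷ us)
  closed-list⇒cycle b []       _              _   (b-b ∷ []) _   = ⊥-elim (adj-irrefl b-b refl)
  closed-list⇒cycle b (u ∷ us) (_ ∷ distinct) unm adj        len =
    fromList-between (close (b ∷ u ∷ us)) adj alternates ((b , u) , _ , refl , bu) ends-unmatched
      (_ , refl) (b ∷ u ∷ us , refl)
    where
      bu : M b u ≡ false
      bu = M-sym (unm u (there (here refl)))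

      alternates : Alternating M (pairs (close (b ∷ u ∷ us)))
      alternates = sparse-alternating bu (cycle-sparse (u ∷ us) distinct (λ x → unm x ∘′ there))
        (suc-injective (trans len (cong (suc ∘′ (2 *_)) (countM-unmatched (pairs (u ∷ us ++ [ b ])) bu))))

      ends-unmatched : EdgesEndWith false (pairs (close (b ∷ u ∷ us)))
      ends-unmatched with pairs-∷ʳ b (u ∷ us) b
      ... | x , x∈ , eq = (x , b) , pairs (b ∷ u ∷ us) , eq , unm x x∈

  blossom⇒cycle : (B : Blossom G M) →
    Σ (AltWalk (base B) (base B) false false) λ C → ∀ {y} → y ∈ vertices B → y ∈ verticesᵂ C
  blossom⇒cycle B with ∈-∃++ (base∈ B)
  ... | xs , ys , vs≡ = C , covers
    where
      b₀ = base B
      others = ys ++ xs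

      rotation : xs ++ b₀ ∷ ys ↭ b₀ ∷ others
      rotation = ↭-trans (shift b₀ xs ys) (↭-prep b₀ (++-comm xs ys))

      edge-rotation : pairs (close (vertices B)) ↭ pairs (close (b₀ ∷ others))
      edge-rotation = subst (λ vs → pairs (close vs) ↭ pairs (close (b₀ ∷ others))) (sym vs≡)
        (pairs-close-rotate xs (b₀ ∷ ys))

      length≡ : length (pairs (close (b₀ ∷ others))) ≡ suc (2 * countM M (pairs (close (b₀ ∷ others))))
      length≡ = begin
        length (pairs (close (b₀ ∷ others)))             ≡⟨ sym (↭-length edge-rotation) ⟩
        length (pairs (close (vertices B)))              ≡⟨ length-pairs-∷ʳ (v₀ B) (rest B) (v₀ B) ⟩
        length (vertices B)                              ≡⟨ len B ⟩
        suc (2 * k B)                                    ≡⟨ cong (suc ∘′ (2 *_)) k≡ ⟩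
        suc (2 * countM M (pairs (close (b₀ ∷ others)))) ∎
        where
          open ≡-Reasoning
          k≡ = trans (sym (kMedges B)) (countM-↭ edge-rotation)

      cycle : Σ (AltWalk b₀ b₀ false false) λ C → verticesᵂ C ≡ close (b₀ ∷ others)
      cycle = closed-list⇒cycle b₀ others
        (distinct-↭ rotation (subst (AllPairs _≢_) vs≡ (distinct B)))
        (λ u u∈ → M-sym (baseUnmatched B u (subst (u ∈_) (sym vs≡) (∈-resp-↭ (↭-sym rotation) u∈))))
        (All-resp-↭ edge-rotation (adjacent B))
        length≡

      C = proj₁ cycle

      covers : ∀ {y} → y ∈ vertices B → y ∈ verticesᵂ C
      covers {y} y∈ = subst (y ∈_) (sym (proj₂ cycle)) (∈-++⁺ˡ (∈-resp-↭ rotation (subst (y ∈_) vs≡ y∈)))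

  loop-free : ∀ us {k} → AllAdjacent G (pairs (close (b ∷ us))) → length us ≡ 2 * k → 1 ≤ k
  loop-free []      (b-b ∷ []) _ = ⊥-elim (adj-irrefl b-b refl)
  loop-free (_ ∷ _) {suc _}  _ _ = s≤s z≤n

  cycle⇒blossom : (C : AltWalk b b false false) → verticesᵂ C ≡ close (b ∷ us) →
    AllPairs _≢_ (μ b ∷ b ∷ us) → Blossom G M
  cycle⇒blossom {b} {us} C C≡ distinct′ = record
    { k             = K
    ; k≥1           = loop-free us adj (suc-injective len′)
    ; v₀            = b
    ; rest          = us
    ; len           = len′
    ; distinct      = AllPairs.tail distinct′
    ; adjacent      = adj
    ; kMedges       = refl
    ; base          = b
    ; base∈         = here refl
    ; baseUnmatched = base-unmatched
    }
    where
      K = countM M (pairs (close (b ∷ us)))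

      adj : AllAdjacent G (pairs (close (b ∷ us)))
      adj = subst (AllAdjacent G ∘′ pairs) C≡ (adjacentᵂ C)

      len′ : suc (length us) ≡ suc (2 * K)
      len′ = trans (sym (length-pairs-∷ʳ b us b))
        (subst (λ vs → length (pairs vs) ≡ suc (2 * countM M (pairs vs))) C≡ (matched-count C))

      base-unmatched : ∀ w → w ∈ b ∷ us → M b w ≡ false
      base-unmatched w w∈ with M b w in bw
      ... | false = refl
      ... | true  = ⊥-elim (All.lookup (AllPairs.head distinct′) w∈ (sym (μ-unique bw)))

  jposy⇒walk : (J : Jposy G M) → Σ (AltWalk (base (B₁ J)) (base (B₂ J)) true true) λ P → verticesᵂ P ≡ walk J
  jposy⇒walk J =
    fromList-between (walk J) (walkAdj J) (alternating J) (firstEdge J) (lastEdge J) (startBase J) (endBase J)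

  odd-length : (W : AltWalk a c true true) → ∃[ m ] length (pairs (verticesᵂ W)) ≡ suc (2 * m)
  odd-length W with countM M (pairs (verticesᵂ W)) | matched-count W
  ... | suc m | eq = m , suc-injective (trans (suc-injective eq) (*-suc 2 m))

  walk⇒jposy : (B₁ B₂ : Blossom G M) (W : AltWalk a c true true) → a ≡ base B₁ → c ≡ base B₂ → Jposy G M
  walk⇒jposy B₁ B₂ W a≡ c≡ = record
    { B₁          = B₁
    ; B₂          = B₂
    ; walk        = verticesᵂ W
    ; walkAdj     = adjacentᵂ W
    ; oddLength   = odd-length W
    ; alternating = alternatingᵂ W
    ; firstEdge   = first-edge W
    ; lastEdge    = last-edge W
    ; startBase   = successors W , cong (_∷ successors W) a≡
    ; endBase     = map₂ (λ eq → trans eq (cong (λ x → _ ++ [ x ]) c≡)) (verticesᵂ-∷ʳ W)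
    }

  -- The digraph D(G, M)

  infix 4 _⟶_ _↝_ _⇄_

  -- An arc a ⟶ b stands for the alternating path a, μ a, b; so the paths of D(G, M) are the
  -- alternating walks that start with a matched edge and end with an unmatched one.
  _⟶_ : Fin n → Fin n → Set
  a ⟶ b = Adj G (μ a) b ≡ true × M (μ a) b ≡ false

  _↝_ : Fin n → Fin n → Set
  _↝_ = Star _⟶_

  _⇄_ : Fin n → Fin n → Set
  a ⇄ b = a ↝ b × b ↝ a

  ⇄-via : z ⇄ a → z ⇄ b → a ⇄ b
  ⇄-via (z↝a , a↝z) (z↝b , b↝z) = a↝z ◅◅ z↝b , b↝z ◅◅ z↝a

  partner-adj⇒↝ : Adj G (μ a) b ≡ true → a ↝ b
  partner-adj⇒↝ {a} {b} e with M (μ a) b in q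
  ... | false = (e , q) ◅ ε
  ... | true  = subst (a ↝_) (trans (sym (μ-involutive a)) (sym (μ-unique q))) ε

  adj⇒↝ : Adj G a b ≡ true → μ a ↝ b
  adj⇒↝ {a} {b} e = partner-adj⇒↝ (subst (λ x → Adj G x b ≡ true) (sym (μ-involutive a)) e)

  walk⇒↝ : AltWalk a c true false → a ↝ c
  walk⇒↝ (step _ q w) with μ-unique q
  walk⇒↝ (step _ _ (edge e q))   | refl = (e , q) ◅ ε
  walk⇒↝ (step _ _ (step e q w)) | refl = (e , q) ◅ walk⇒↝ w

  -- A walk leaving y along a matched edge passes through the vertex y of D(G, M), one leaving it
  -- along an unmatched edge through μ y.
  anchor : Bool → Fin n → Fin n
  anchor true  y = y
  anchor false y = μ y

  visit⇒↝ : (w : AltWalk a c true false) → Visits y u w → a ↝ anchor u y × anchor u y ↝ c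
  visit⇒↝ w start = ε , walk⇒↝ w
  visit⇒↝ {a = a} w@(step _ q _) (later start) with μ-unique q
  ... | refl = subst (λ x → a ↝ x × x ↝ _) (sym (μ-involutive a)) (ε , walk⇒↝ w)
  visit⇒↝ w@(step _ _ (edge _ _)) (later end) = walk⇒↝ w , ε
  visit⇒↝ (step _ q (step e q′ w)) (later (later v)) with μ-unique q
  ... | refl = map₁ ((e , q′) ◅_) (visit⇒↝ w v)

  visited-both-ways : (w w′ : AltWalk z z true false) → Visits y u w → Visits y (not u) w′ → y ⇄ μ y
  visited-both-ways {u = true}  w w′ v v′ = ⇄-via (visit⇒↝ w v) (visit⇒↝ w′ v′)
  visited-both-ways {u = false} w w′ v v′ = ⇄-via (visit⇒↝ w′ v′) (visit⇒↝ w v)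

  jposy⇒⇄ : (J : Jposy G M) → OnJposy v J → v ⇄ μ v
  jposy⇒⇄ {v} J = on-tours
    where
      b₁ = base (B₁ J)
      b₂ = base (B₂ J)
      P  = proj₁ (jposy⇒walk J)
      C₁ = proj₁ (blossom⇒cycle (B₁ J))
      C₂ = proj₁ (blossom⇒cycle (B₂ J))

      tour : AltWalk b₂ b₂ false false → AltWalk b₁ b₁ false false → AltWalk b₁ b₁ true false
      tour f₂ f₁ = P ++ᵂ f₂ ++ᵂ rev P ++ᵂ f₁

      on-P : ∀ f₂ f₁ → Visits v u P → Visits v u (tour f₂ f₁)
      on-P f₂ f₁ = visits-++ˡ P _

      on-rev-P : ∀ f₂ f₁ → Visits v u (rev P) → Visits v u (tour f₂ f₁)
      on-rev-P f₂ f₁ = visits-++ʳ P _ ∘′ visits-++ʳ f₂ _ ∘′ visits-++ˡ (rev P) f₁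

      on-f₁ : ∀ f₂ f₁ → Visits v u f₁ → Visits v u (tour f₂ f₁)
      on-f₁ f₂ f₁ = visits-++ʳ P _ ∘′ visits-++ʳ f₂ _ ∘′ visits-++ʳ (rev P) f₁

      on-f₂ : ∀ f₂ f₁ → Visits v u f₂ → Visits v u (tour f₂ f₁)
      on-f₂ f₂ f₁ = visits-++ʳ P _ ∘′ visits-++ˡ f₂ _

      on-tours : OnJposy v J → v ⇄ μ v
      on-tours (inj₁ v∈B₁) with ∈⇒visits C₁ (proj₂ (blossom⇒cycle (B₁ J)) v∈B₁)
      ... | _ , vis = visited-both-ways (tour C₂ C₁) (tour C₂ (rev C₁))
        (on-f₁ C₂ C₁ vis) (on-f₁ C₂ (rev C₁) (rev-visits C₁ vis))
      on-tours (inj₂ (inj₁ v∈B₂)) with ∈⇒visits C₂ (proj₂ (blossom⇒cycle (B₂ J)) v∈B₂)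
      ... | _ , vis = visited-both-ways (tour C₂ C₁) (tour (rev C₂) C₁)
        (on-f₂ C₂ C₁ vis) (on-f₂ (rev C₂) C₁ (rev-visits C₂ vis))
      on-tours (inj₂ (inj₂ v∈P)) with ∈⇒visits P (subst (v ∈_) (sym (proj₂ (jposy⇒walk J))) v∈P)
      ... | _ , vis = visited-both-ways (tour C₂ C₁) (tour C₂ C₁)
        (on-P C₂ C₁ vis) (on-rev-P C₂ C₁ (rev-visits P vis))

  -- Finding a blossom

  Flower : Fin n → Set
  Flower r = Σ (Blossom G M) λ B → AltWalk r (base B) true true

  module BlossomSearch (r : Fin n) where

    open import Data.List.Membership.DecPropositional (_≟ᶠ_ {n}) using (_∈?_)

    private variable
      ℓ ℓ′ : Bool

    -- Simple alternating paths from r, listed from their last vertex back to r and indexed by the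
    -- status of their last edge (false for the trivial path, which continues with a matched edge).
    mutual
      data Path : Fin n → Bool → Set where
        root   : Path r false
        extend : (p : Path a ℓ) → Adj G a b ≡ true → M a b ≡ not ℓ → b ∉ verticesᴾ p → Path b (not ℓ)

      verticesᴾ : Path a ℓ → List (Fin n)
      verticesᴾ {a = a} p = a ∷ earlier p

      earlier : Path a ℓ → List (Fin n)
      earlier root             = []
      earlier (extend p _ _ _) = verticesᴾ p

    path-distinct : (p : Path a ℓ) → AllPairs _≢_ (verticesᴾ p)
    path-distinct root              = [] ∷ []
    path-distinct (extend p _ _ b∉) = ¬Any⇒All¬ (verticesᴾ p) b∉ ∷ path-distinct p

    data _≺_ {b ℓ′} (p′ : Path b ℓ′) : ∀ {a ℓ} → Path a ℓ → Set where
      here  : ∀ {c e q c∉} → p′ ≺ extend {b = c} p′ e q c∉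
      there : ∀ {a ℓ c} {p : Path a ℓ} {e q c∉} → p′ ≺ p → p′ ≺ extend {b = c} p e q c∉

    from-root : (p : Path a ℓ) {e : Adj G a c ≡ true} {q : M a c ≡ not ℓ} {c∉ : c ∉ verticesᴾ p} →
      root ≺ extend p e q c∉
    from-root root             = here
    from-root (extend p _ _ _) = there (from-root p)

    newer : {p′ : Path b ℓ′} {p : Path a ℓ} → p′ ≺ p → List (Fin n)
    newer (here {c = c})    = [ c ]
    newer (there {c = c} x) = c ∷ newer x

    verticesᴾ-≺ : {p′ : Path b ℓ′} {p : Path a ℓ} (x : p′ ≺ p) → verticesᴾ p ≡ newer x ++ verticesᴾ p′
    verticesᴾ-≺ here              = refl
    verticesᴾ-≺ (there {c = c} x) = cong (c ∷_) (verticesᴾ-≺ x)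

    segment : {p′ : Path b ℓ′} {p : Path a ℓ} → p′ ≺ p → AltWalk b a (not ℓ′) ℓ
    segment (here {e = e} {q})    = edge e q
    segment (there {e = e} {q} x) = segment x ++ᵂ edge e q

    verticesᵂ-segment : {p′ : Path b ℓ′} {p : Path a ℓ} (x : p′ ≺ p) →
      verticesᵂ (segment x) ≡ b ∷ reverse (newer x)
    verticesᵂ-segment here = refl
    verticesᵂ-segment {b = b} (there {c = c} {e = e} {q} x) = begin
      verticesᵂ (segment x ++ᵂ edge e q) ≡⟨ verticesᵂ-++ᵂ (segment x) (edge e q) ⟩
      verticesᵂ (segment x) ++ [ c ]     ≡⟨ cong (_++ [ c ]) (verticesᵂ-segment x) ⟩
      b ∷ reverse (newer x) ++ [ c ]     ≡⟨ cong (b ∷_) (sym (unfold-reverse c (newer x))) ⟩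
      b ∷ reverse (c ∷ newer x)          ∎
      where open ≡-Reasoning

    successor : {p′ : Path b ℓ′} {p : Path a ℓ} → p′ ≺ p → ∃[ d ] M b d ≡ not ℓ′ × d ∈ verticesᴾ p
    successor (here {c = c} {q = q}) = c , q , here refl
    successor (there x) with successor x
    ... | d , q , d∈ = d , q , there d∈

    split : (p : Path a ℓ) → b ∈ verticesᴾ p → b ≡ a ⊎ ∃[ ℓ′ ] Σ (Path b ℓ′) (_≺ p)
    split p                (here refl) = inj₁ refl
    split (extend p _ _ _) (there b∈) with split p b∈
    ... | inj₁ refl          = inj₂ (_ , p , here)
    ... | inj₂ (ℓ′ , p′ , x) = inj₂ (ℓ′ , p′ , there x)

    matched-chord : {p′ : Path b ℓ′} {p : Path a ℓ} → p′ ≺ p → M a b ≡ true → ℓ′ ≡ false → ℓ ≡ true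
    matched-chord here                _  ℓ′≡ = cong not ℓ′≡
    matched-chord (there {c∉ = a∉} x) ab ℓ′≡ with successor x
    ... | d , bd , d∈ = ⊥-elim (a∉ (subst (_∈ _) (sym (matched-twice ab (trans bd (cong not ℓ′≡)))) d∈))

    matched-entry : (p : Path b ℓ) → ℓ ≡ true → root ≺ p × ∃[ es ] earlier p ≡ μ b ∷ es
    matched-entry (extend p _ q _) entered =
      from-root p , earlier p , cong (_∷ earlier p) (μ-unique (M-sym (trans q entered)))

    close-cycle : {p′ : Path b ℓ} {p : Path a ℓ} → p′ ≺ p → Adj G a b ≡ true → M a b ≡ not ℓ → Flower r
    close-cycle {ℓ = false} x _ ab with () ← matched-chord x ab refl
    close-cycle {b = b} {ℓ = true} {p′ = p′} {p = p} x e ab with matched-entry p′ refl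
    ... | from-r , es , earlier≡ = cycle⇒blossom C C≡ distinct-cycle , segment from-r
      where
        C : AltWalk b b false false
        C = segment x ++ᵂ edge e ab

        C≡ : verticesᵂ C ≡ close (b ∷ reverse (newer x))
        C≡ = trans (verticesᵂ-++ᵂ (segment x) (edge e ab)) (cong (_++ [ b ]) (verticesᵂ-segment x))

        path≡ : verticesᴾ p ≡ (newer x ++ b ∷ μ b ∷ []) ++ es
        path≡ = trans (verticesᴾ-≺ x)
          (trans (cong (λ vs → newer x ++ b ∷ vs) earlier≡) (sym (++-assoc (newer x) (b ∷ μ b ∷ []) es)))

        rearrange : newer x ++ b ∷ μ b ∷ [] ↭ μ b ∷ b ∷ reverse (newer x)
        rearrange = ↭-trans (++-comm (newer x) (b ∷ μ b ∷ [])) (↭-swap b (μ b) (↭-sym (↭-reverse (newer x))))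

        distinct-cycle : AllPairs _≢_ (μ b ∷ b ∷ reverse (newer x))
        distinct-cycle = distinct-↭ rearrange
          (AllPairs-++⁻ˡ (newer x ++ b ∷ μ b ∷ []) (subst (AllPairs _≢_) path≡ (path-distinct p)))

    -- If b is already on p, it either recurs with the parity it would now get (then cut p back to
    -- it) or with the other one (then the edge a b closes an odd cycle).
    insert : (p : Path a ℓ) → Adj G a b ≡ true → M a b ≡ not ℓ → Flower r ⊎ Path b (not ℓ)
    insert {a} {ℓ} {b} p e q with b ∈? verticesᴾ p
    ... | no b∉ = inj₂ (extend p e q b∉)
    ... | yes b∈ with split p b∈
    ...   | inj₁ refl = ⊥-elim (adj-irrefl e refl)
    ...   | inj₂ (ℓ′ , p′ , x) with ℓ′ ≟ᵇ not ℓ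
    ...     | yes refl = inj₂ p′
    ...     | no ℓ′≢ with trans (¬-not ℓ′≢) (not-involutive ℓ)
    ...       | refl = inj₁ (close-cycle x e q)

    follow : Path a false → a ↝ c → Flower r ⊎ Path c false
    follow     p ε                 = inj₂ p
    follow {a} p ((e , q) ◅ steps) with insert p (adj-μ a) (matched-μ a)
    ... | inj₁ F  = inj₁ F
    ... | inj₂ p₁ with insert p₁ e q
    ...   | inj₁ F  = inj₁ F
    ...   | inj₂ p₂ = follow p₂ steps

    partner-on-path : (p : Path a ℓ) → (a ≡ r × ℓ ≡ false) ⊎ (μ r ∈ verticesᴾ p × (a ≡ μ r → ℓ ≡ true))
    partner-on-path root = inj₁ (refl , refl)
    partner-on-path (extend p e q b∉) with partner-on-path p
    ... | inj₁ (refl , refl) = inj₂ (here (sym (μ-unique q)) , λ _ → refl)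
    ... | inj₂ (μr∈ , _)     = inj₂ (there μr∈ , λ b≡ → ⊥-elim (b∉ (subst (_∈ verticesᴾ p) (sym b≡) μr∈)))

    flower : r ↝ μ r → Flower r
    flower steps with follow root steps
    ... | inj₁ F = F
    ... | inj₂ p with partner-on-path p
    ...   | inj₁ (μr≡r , _)         = ⊥-elim (adj-irrefl (adj-μ r) (sym μr≡r))
    ...   | inj₂ (_ , ends-matched) with () ← ends-matched refl

  ⇄⇒jposy : v ⇄ μ v → Σ (Jposy G M) (OnJposy v)
  ⇄⇒jposy {v} (v↝μv , μv↝v) = join (split-first (proj₂ F₂) (M-sym (matched-μ v)))
    where
      F₁ = BlossomSearch.flower v v↝μv
      F₂ = BlossomSearch.flower (μ v) (subst (μ v ↝_) (sym (μ-involutive v)) μv↝v)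
      blossom₁ = proj₁ F₁
      blossom₂ = proj₁ F₂

      W₁ : AltWalk (base blossom₁) v true true
      W₁ = rev (proj₂ F₁)

      join : base blossom₂ ≡ v ⊎ AltWalk v (base blossom₂) false true → Σ (Jposy G M) (OnJposy v)
      join (inj₁ b₂≡v) =
        walk⇒jposy blossom₁ blossom₂ W₁ refl (sym b₂≡v) , inj₂ (inj₂ (visits⇒∈ (visits-end W₁)))
      join (inj₂ W₂) =
        walk⇒jposy blossom₁ blossom₂ (W₁ ++ᵂ W₂) refl refl ,
        inj₂ (inj₂ (visits⇒∈ (visits-++ˡ W₁ W₂ (visits-end W₁))))

module Transfer {n : ℕ} (G : SimpleGraph n) {M M′ : Fin n → Fin n → Bool}
  (pm : IsPerfectMatching G M) (pm′ : IsPerfectMatching G M′) where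

  open Matching G M pm
  module D′ = Matching G M′ pm′

  private
    g : Fin n → Fin n
    g a = D′.μ (μ a)

    g-injective : Injective _≡_ _≡_ g
    g-injective {a} {b} eq = begin
      a              ≡⟨ sym (μ-involutive a) ⟩
      μ (μ a)        ≡⟨ cong μ (sym (D′.μ-involutive (μ a))) ⟩
      μ (D′.μ (g a)) ≡⟨ cong (μ ∘′ D′.μ) eq ⟩
      μ (D′.μ (g b)) ≡⟨ cong μ (D′.μ-involutive (μ b)) ⟩
      μ (μ b)        ≡⟨ μ-involutive b ⟩
      b              ∎
      where open ≡-Reasoning

  ↝-partner′-partner : ∀ a → a ↝ μ (D′.μ a)
  ↝-partner′-partner a = subst (_↝ μ (D′.μ a)) g-returns
    (star-back g-injective (λ b → partner-adj⇒↝ (D′.adj-μ (μ b))) (μ (D′.μ a)))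
    where
      g-returns : g (μ (D′.μ a)) ≡ a
      g-returns = trans (cong D′.μ (μ-involutive (D′.μ a))) (D′.μ-involutive a)

  arc′⇒↝ : ∀ {a b} → a D′.⟶ b → a ↝ b
  arc′⇒↝ {a} (e , _) = ↝-partner′-partner a ◅◅ adj⇒↝ e

  ⇄-transfer : ∀ {v} → v D′.⇄ D′.μ v → v ⇄ μ v
  ⇄-transfer {v} (v↝′ , ↝′v) =
    (arc′⇒↝ ⋆) v↝′ ◅◅ subst (D′.μ v ↝_) (cong μ (D′.μ-involutive v)) (↝-partner′-partner (D′.μ v)) ,
    adj⇒↝ (D′.adj-μ v) ◅◅ (arc′⇒↝ ⋆) ↝′v

mainTheorem4 : (n : ℕ) (G : SimpleGraph n) (M : Fin n → Fin n → Bool) →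
    IsPerfectMatching G M → (v : Fin n) → InVSD G v →
    Σ (Jposy G M) (λ J → OnJposy v J)
mainTheorem4 n G M pm v (M′ , pm′ , J , v∈J) =
  Matching.⇄⇒jposy G M pm (Transfer.⇄-transfer G pm pm′ (Matching.jposy⇒⇄ G M′ pm′ J v∈J))
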